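{- Let $G$ be a finite graph and consider the Maker-Breaker domination game on $G$ (D-game or S-game) in the variant where, on his or her turn, a player may skip (pass), i.e. select no vertex, after which the other player moves; skipped moves are not counted as moves. Then: (a) if only Staller is allowed to skip, Dominator still has a strategy guaranteeing that he dominates $G$ within at most $\gamma_{\rm MB}(G)$ of his own moves in the D-game (resp. within at most $\gamma_{\rm MB}'(G)$ of his own moves in the S-game); that is, Staller skipping a move can never disadvantage Dominator. (b) If Dominator is allowed to skip, it is never an advantage for him: Staller still has a strategy guaranteeing that Dominator does not dominate $G$ with fewer than $\gamma_{\rm MB}(G)$ of his own moves in the D-game (resp. fewer than $\gamma_{\rm MB}'(G)$ in the S-game).
   Context: All graphs are finite and simple. A set $D\subseteq V(G)$ is dominating if every vertex is in $D$ or adjacent to a vertex of $D$. The Maker-Breaker domination game on $G$ is played by Dominator and Staller, who alternately select a vertex of $G$ not selected before. Dominator wins if at some point the set of vertices he has selected is a dominating set of $G$; Staller wins if this never happens. The D-game is the game in which Dominator moves first; the S-game the one in which Staller moves first. $\gamma_{\rm MB}(G)$ is the minimum number $k$ such that Dominator has a strategy in the D-game guaranteeing that his selected vertices form a dominating set after at most $k$ of his moves, whatever Staller does; $\gamma_{\rm MB}(G)=\infty$ if Dominator has no winning strategy. $\gamma_{\rm MB}'(G)$ is defined analogously for the S-game. -}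

module Defs where

open import Data.Nat using (ℕ; zero; suc; _≤_)
open import Data.Bool using (Bool; true; false)
open import Data.Fin using (Fin)
open import Data.List using (List; []; _∷_)
open import Data.List.Membership.Propositional using (_∈_; _∉_)
open import Data.Product using (Σ; ∃; _×_)
open import Data.Sum using (_⊎_)
open import Relation.Binary.PropositionalEquality using (_≡_)

record Graph (n : ℕ) : Set where
  field
    adj    : Fin n → Fin n → Bool
    sym    : ∀ u v → adj u v ≡ adj v u
    irrefl : ∀ v → adj v v ≡ false
open Graph public

Dominates : ∀ {n} → Graph n → List (Fin n) → Set
Dominates G D = ∀ v → (v ∈ D) ⊎ (Σ (Fin _) λ u → (u ∈ D) × (adj G u v ≡ true))

Free : ∀ {n} → List (Fin n) → List (Fin n) → Fin n → Set
Free D S v = (v ∉ D) × (v ∉ S)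

data Turn : Set where
  DomTurn StaTurn : Turn

-- Wins G dSkip sSkip k t D S : in the position where Dominator has selected D,
-- Staller has selected S, and it is t's turn, Dominator has a strategy that
-- guarantees his selected set becomes dominating after at most k further moves
-- of his own (skips are not counted).  dSkip / sSkip say whether Dominator /
-- Staller may skip.  Inductive (least fixed point): every play consistent with
-- the strategy must reach domination in finitely many steps; an infinite play
-- or a play ending with all vertices selected and no domination is a Staller win.
data Wins {n : ℕ} (G : Graph n) (dSkip sSkip : Bool)
     : ℕ → Turn → List (Fin n) → List (Fin n) → Set where
  done  : ∀ {k t D S} → Dominates G D → Wins G dSkip sSkip k t D S
  dMove : ∀ {k D S} (v : Fin n) → Free D S v →
          Wins G dSkip sSkip k StaTurn (v ∷ D) S →
          Wins G dSkip sSkip (suc k) DomTurn D S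
  dPass : ∀ {k D S} → dSkip ≡ true →
          Wins G dSkip sSkip k StaTurn D S →
          Wins G dSkip sSkip k DomTurn D S
  sMove : ∀ {k D S} → ∃ (Free D S) →
          (∀ v → Free D S v → Wins G dSkip sSkip k DomTurn D (v ∷ S)) →
          (sSkip ≡ true → Wins G dSkip sSkip k DomTurn D S) →
          Wins G dSkip sSkip k StaTurn D S

-- γ_MB(G) = k (t = DomTurn, D-game) or γ'_MB(G) = k (t = StaTurn, S-game),
-- in the ordinary game without skipping.  "γ = ∞" means no k satisfies this.
IsγMB : ∀ {n} → Graph n → Turn → ℕ → Set
IsγMB G t k = Wins G false false k t [] [] × (∀ j → Wins G false false j t [] [] → k ≤ j)

{-# OPTIONS --safe #-}
-- A Dominator strategy in any skipping variant converts into one that never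
-- skips and copes with Staller skipping, at no extra cost in Dominator moves.
-- Dominator pretends that Staller has selected more vertices than she really
-- has: a Dominator skip becomes "Staller already answered with some free
-- vertex w", and a Staller skip, or a Staller selection Dominator has already
-- pretended, becomes "Staller selected some free vertex w".  Staller's real
-- set stays inside the imagined one, and a vertex free in the imagined game is
-- free in the real one.  This gives (a), and for (b) it gives a skip-free win
-- within j moves; since the skip-free game is finite, winning within k moves
-- is decidable, so γ_MB exists and is at most j.
module Submission where

open import Defs
open import Data.Nat using (ℕ; zero; suc; _≤_; z≤n; s≤s)
open import Data.Bool using (Bool; true; false)
import Data.Bool.Properties as Bool
open import Data.Empty using (⊥-elim)
import Data.Fin.Properties as Fin
open import Data.List using ([]; _∷_)
open import Data.List.Relation.Unary.Any using (here; there)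
open import Data.List.Relation.Binary.Subset.Propositional using (_⊆_)
open import Data.List.Relation.Binary.Subset.Propositional.Properties
  using (⊆-refl; xs⊆x∷xs; ∷⁺ʳ)
open import Data.Product using (Σ; _×_; _,_; proj₁)
open import Function using (_∘_)
open import Relation.Nullary using (Dec; yes; no)
open import Relation.Nullary.Decidable using (_×-dec_; _⊎-dec_; _→-dec_; ¬?)
open import Relation.Binary.PropositionalEquality using (refl)

module _ {n : ℕ} (G : Graph n) where

  open import Data.List.Membership.DecPropositional (Fin._≟_ {n}) using (_∈?_)

  Wins-dropPasses : ∀ {dSkip sSkip sSkip′ k t D S S′} →
                    Wins G dSkip sSkip k t D S → S′ ⊆ S →
                    Wins G false sSkip′ k t D S′
  Wins-dropPasses (done dom) S′⊆S = done dom
  Wins-dropPasses (dMove v (v∉D , v∉S) win) S′⊆S =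
    dMove v (v∉D , λ v∈S′ → v∉S (S′⊆S v∈S′)) (Wins-dropPasses win S′⊆S)
  Wins-dropPasses (dPass _ (done dom)) S′⊆S = done dom
  Wins-dropPasses (dPass _ (sMove (w , free) win _)) S′⊆S =
    Wins-dropPasses (win w free) (xs⊆x∷xs _ w ∘ S′⊆S)
  Wins-dropPasses {D = D} {S} {S′} (sMove (w , w∉D , w∉S) win _) S′⊆S =
    sMove (w , w∉D , λ w∈S′ → w∉S (S′⊆S w∈S′)) reply (λ _ → imagineW (xs⊆x∷xs S w ∘ S′⊆S))
    where
    imagineW : ∀ {S″} → S″ ⊆ w ∷ S → Wins G false _ _ DomTurn D S″
    imagineW = Wins-dropPasses (win w (w∉D , w∉S))

    reply : ∀ v → Free D S′ v → Wins G false _ _ DomTurn D (v ∷ S′)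
    reply v (v∉D , _) with v ∈? S
    ... | yes v∈S = imagineW λ { (here refl) → there v∈S ; (there u∈S′) → there (S′⊆S u∈S′) }
    ... | no v∉S  = Wins-dropPasses (win v (v∉D , v∉S)) (∷⁺ʳ v S′⊆S)

  dominates? : ∀ D → Dec (Dominates G D)
  dominates? D = Fin.all? λ v → v ∈? D ⊎-dec Fin.any? (λ u → u ∈? D ×-dec adj G u v Bool.≟ true)

  free? : ∀ D S v → Dec (Free D S v)
  free? D S v = ¬? (v ∈? D) ×-dec ¬? (v ∈? S)

  module _ {sSkip : Bool} where

    domWins? : ∀ k D S → Dec (Wins G false sSkip k DomTurn D S)
    staWins? : ∀ k D S → Dec (Wins G false sSkip k StaTurn D S)

    domWins? k D S with dominates? D
    ... | yes dom = yes (done dom)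
    domWins? zero D S | no ¬dom = no λ { (done dom) → ¬dom dom ; (dPass () _) }
    domWins? (suc k) D S | no ¬dom with Fin.any? (λ v → free? D S v ×-dec staWins? k (v ∷ D) S)
    ... | yes (v , free , win) = yes (dMove v free win)
    ... | no ¬move = no λ { (done dom) → ¬dom dom
                          ; (dMove v free win) → ¬move (v , free , win)
                          ; (dPass () _) }

    staWins? k D S with dominates? D
    ... | yes dom = yes (done dom)
    ... | no ¬dom
      with Fin.any? (free? D S)
         | Fin.all? (λ v → free? D S v →-dec domWins? k D (v ∷ S))
         | (sSkip Bool.≟ true) →-dec domWins? k D S
    ... | yes ∃free | yes replies | yes skip = yes (sMove ∃free replies skip)
    ... | no ¬∃free | _ | _ = no λ { (done dom) → ¬dom dom ; (sMove ∃free _ _) → ¬∃free ∃free }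
    ... | _ | no ¬replies | _ = no λ { (done dom) → ¬dom dom ; (sMove _ replies _) → ¬replies replies }
    ... | _ | _ | no ¬skip = no λ { (done dom) → ¬dom dom ; (sMove _ _ skip) → ¬skip skip }

    Wins? : ∀ k t D S → Dec (Wins G false sSkip k t D S)
    Wins? k DomTurn = domWins? k
    Wins? k StaTurn = staWins? k

least-≤-witness : ∀ {p} (P : ℕ → Set p) → (∀ i → Dec (P i)) → ∀ {j} → P j →
                  Σ ℕ λ k → (P k × (∀ i → P i → k ≤ i)) × k ≤ j
least-≤-witness P P? {zero} p₀ = zero , (p₀ , λ _ _ → z≤n) , z≤n
least-≤-witness P P? {suc j} pⱼ with P? zero
... | yes p₀ = zero , (p₀ , λ _ _ → z≤n) , z≤n
... | no ¬p₀ with least-≤-witness (P ∘ suc) (P? ∘ suc) pⱼ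
... | k , (pₖ , least) , k≤j = suc k , (pₖ , leastˢ) , s≤s k≤j
  where
  leastˢ : ∀ i → P i → suc k ≤ i
  leastˢ zero    p₀ = ⊥-elim (¬p₀ p₀)
  leastˢ (suc i) pᵢ = s≤s (least i pᵢ)

lemma2 : ∀ {n} (G : Graph n) (t : Turn) →
    ((k : ℕ) → IsγMB G t k → Wins G false true k t [] [])
    × ((j : ℕ) → Wins G true false j t [] [] → Σ ℕ λ k → IsγMB G t k × k ≤ j)
lemma2 G t =
    (λ k γ → Wins-dropPasses G (proj₁ γ) ⊆-refl)
  , (λ j win → least-≤-witness (λ i → Wins G false false i t [] [])
                               (λ i → Wins? G i t [] [])
                               (Wins-dropPasses G win ⊆-refl))
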